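{- Let $A$ be a justified AJM game, $\sigma$ a strategy on $A$, and $\phi$ a set of even-length plays of $A$. Then $\phi$ is a skeleton of $\sigma$ if and only if $\phi$ is a skeleton (in the general sense) and $\phi^\bullet=\sigma$, where $\phi^\bullet=\{t\mid\exists s\in\phi.\ s\approx_A t\}$.
   Context: A justified AJM game $A=(M_A,\lambda_A,\mathsf{j}_A,P_A,\approx_A)$: set of moves; labelling $\lambda_A:M_A\to\{P,O\}\times\{Q,A\}$; a partial justification function (well-founded; P-moves justified by O-moves and vice versa; answers justified by questions); a non-empty prefix-closed set $P_A$ of finite move sequences (plays) which start with an O-move, alternate O/P, contain each move at most once, are prefixes of well-bracketed strings, and contain the justifier of each move earlier; an equivalence $\approx_A$ on $P_A$ such that (e1) $s\approx_A t$ implies equal label sequences, (e2) equal-length prefixes of equivalent plays are equivalent, (e3) $s\approx_A t$, $sa\in P_A$ imply $sa\approx_A tb$ for some $b$. A strategy on $A$: a non-empty set $\sigma$ of even-length plays with Causal Consistency ($sab\in\sigma\Rightarrow s\in\sigma$), Representation Independence ($s\in\sigma$, $s\approx_A t\Rightarrow t\in\sigma$), Determinacy ($sab,ta'b'\in\sigma$, $sa\approx_A ta'\Rightarrow sab\approx_A ta'b'$). A skeleton of $\sigma$: a non-empty causally consistent subset $\phi\subseteq\sigma$ satisfying Uniformization (for all $sab\in\sigma$ with $s\in\phi$ there is a unique $b'$ with $sab'\in\phi$). A skeleton in the general sense: a non-empty, causally consistent set $\phi$ of even-length plays satisfying Functional Determinacy ($sab,sac\in\phi\Rightarrow b=c$)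 and Functional Representation Independence (if $sab\in\phi$, $t\in\phi$, $sa\approx_A ta'$ then there is a unique $b'$ with $ta'b'\in\phi$ and $sab\approx_A ta'b'$). -}

module Defs where

open import Data.Nat using (ℕ; zero; suc)
open import Data.List using (List; []; _∷_; _++_; [_]; map; take; length)
open import Data.List.Membership.Propositional using (_∈_)
open import Data.List.Relation.Unary.Unique.Propositional using (Unique)
open import Data.Maybe using (Maybe; just)
open import Data.Product using (Σ; ∃; ∃-syntax; ∃!; _×_; _,_)
open import Data.Unit using (⊤)
open import Data.Empty using (⊥)
open import Function.Bundles using (_⇔_)
open import Induction.WellFounded using (WellFounded)
open import Relation.Binary.PropositionalEquality using (_≡_; _≢_)

data Pol : Set where
  O P : Pol

data Kind : Set where
  Q A : Kind

flipPol : Pol → Pol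
flipPol O = P
flipPol P = O

Even : ℕ → Set
Even zero = ⊤
Even (suc zero) = ⊥
Even (suc (suc n)) = Even n

AltFrom : {M : Set} → (M → Pol) → Pol → List M → Set
AltFrom pol p [] = ⊤
AltFrom pol p (m ∷ s) = pol m ≡ p × AltFrom pol (flipPol p) s

-- "prefix of a well-bracketed string": reading Q as an opening and A as a
-- closing bracket, with n currently open questions.
mutual
  Bracket : {M : Set} → (M → Kind) → ℕ → List M → Set
  Bracket kd n [] = ⊤
  Bracket kd n (m ∷ s) = BracketStep kd n (kd m) s

  BracketStep : {M : Set} → (M → Kind) → ℕ → Kind → List M → Set
  BracketStep kd n Q s = Bracket kd (suc n) s
  BracketStep kd zero A s = ⊥
  BracketStep kd (suc n) A s = Bracket kd n s

JustifiersEarlier : {M : Set} → (M → Maybe M) → List M → Set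
JustifiersEarlier {M} j s =
  (u v : List M) (m n : M) → s ≡ u ++ (m ∷ v) → j m ≡ just n → n ∈ u

record Game : Set₁ where
  field
    Move   : Set
    pol    : Move → Pol
    kind   : Move → Kind
    just?  : Move → Maybe Move
    Play   : List Move → Set
    _≈_    : List Move → List Move → Set
    just-wf     : WellFounded (λ n m → just? m ≡ just n)
    just-pol    : ∀ m n → just? m ≡ just n → pol m ≢ pol n
    just-ans    : ∀ m n → just? m ≡ just n → kind m ≡ A → kind n ≡ Q
    play-nonempty : ∃[ s ] Play s
    play-prefix   : ∀ s t → Play (s ++ t) → Play s
    play-alt      : ∀ s → Play s → AltFrom pol O s
    play-unique   : ∀ s → Play s → Unique s
    play-bracket  : ∀ s → Play s → Bracket kind 0 s
    play-just     : ∀ s → Play s → JustifiersEarlier just? s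
    ≈-plays : ∀ {s t} → s ≈ t → Play s × Play t
    ≈-refl  : ∀ {s} → Play s → s ≈ s
    ≈-sym   : ∀ {s t} → s ≈ t → t ≈ s
    ≈-trans : ∀ {s t u} → s ≈ t → t ≈ u → s ≈ u
    e1 : ∀ {s t} → s ≈ t → map pol s ≡ map pol t × map kind s ≡ map kind t
    e2 : ∀ {s t} → s ≈ t → ∀ n → take n s ≈ take n t
    e3 : ∀ {s t} a → s ≈ t → Play (s ++ [ a ]) →
         ∃[ b ] ((s ++ [ a ]) ≈ (t ++ [ b ]))

module _ (G : Game) where
  open Game G

  EvenPlays : (List Move → Set) → Set
  EvenPlays φ = ∀ s → φ s → Play s × Even (length s)

  CausallyConsistent : (List Move → Set) → Set
  CausallyConsistent φ = ∀ s a b → φ (s ++ a ∷ b ∷ []) → φ s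

  record IsStrategy (σ : List Move → Set) : Set where
    field
      evenPlays : EvenPlays σ
      nonempty  : ∃[ s ] σ s
      causal    : CausallyConsistent σ
      repIndep  : ∀ s t → σ s → s ≈ t → σ t
      determ    : ∀ s a b t a′ b′ → σ (s ++ a ∷ b ∷ []) → σ (t ++ a′ ∷ b′ ∷ []) →
                  (s ++ [ a ]) ≈ (t ++ [ a′ ]) →
                  (s ++ a ∷ b ∷ []) ≈ (t ++ a′ ∷ b′ ∷ [])

  record Strategy : Set₁ where
    field
      set        : List Move → Set
      isStrategy : IsStrategy set

  record IsSkeletonOf (φ : List Move → Set) (σ : List Move → Set) : Set where
    field
      subset   : ∀ s → φ s → σ s
      nonempty : ∃[ s ] φ s
      causal   : CausallyConsistent φ
      uniform  : ∀ s a b → σ (s ++ a ∷ b ∷ []) → φ s →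
                 ∃! _≡_ (λ b′ → φ (s ++ a ∷ b′ ∷ []))

  record IsSkeleton (φ : List Move → Set) : Set where
    field
      evenPlays : EvenPlays φ
      nonempty  : ∃[ s ] φ s
      causal    : CausallyConsistent φ
      funDeterm : ∀ s a b c → φ (s ++ a ∷ b ∷ []) → φ (s ++ a ∷ c ∷ []) → b ≡ c
      funRepIndep : ∀ s a b t a′ → φ (s ++ a ∷ b ∷ []) → φ t →
                    (s ++ [ a ]) ≈ (t ++ [ a′ ]) →
                    ∃! _≡_ (λ b′ → φ (t ++ a′ ∷ b′ ∷ []) ×
                                   (s ++ a ∷ b ∷ []) ≈ (t ++ a′ ∷ b′ ∷ []))

  bullet : (List Move → Set) → (List Move → Set)
  bullet φ t = ∃[ s ] (φ s × s ≈ t)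

  _≐_ : (List Move → Set) → (List Move → Set) → Set
  φ ≐ ψ = ∀ t → φ t ⇔ ψ t

module Submission where

-- Even-length plays are analysed through a "snoc view": every even-length
-- list is either [] or u ++ a ∷ b ∷ [] for a shorter even-length list u, and
-- structural recursion on this view replaces induction on length.
--
-- (⇒) Uniformization plus Determinacy of σ yield Functional Determinacy and
-- Functional Representation Independence of φ; φ• ⊆ σ by Representation
-- Independence, and σ ⊆ φ• by induction along the snoc view, transporting
-- each σ-play move by move onto a φ-play via (e3), Uniformization and
-- Determinacy.
-- (⇐) φ ⊆ φ• = σ, and Uniformization follows by choosing a φ-play equivalent
-- to the given σ-play and applying Functional Representation Independence
-- and Functional Determinacy to it.

open import Defs
open import Data.List using (List)
open import Data.Product using (_×_)
open import Function.Bundles using (_⇔_)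

open import Data.Nat using (ℕ; suc)
open import Data.Nat.Properties using (+-comm; suc-injective)
open import Data.List using ([]; _∷_; _++_; [_]; map; take; length)
open import Data.List.Properties using (++-assoc; length-map; length-++)
open import Data.Product using (∃-syntax; _,_; proj₁; proj₂)
open import Function.Bundles using (mk⇔; module Equivalence)
open import Data.Empty using (⊥-elim)
open import Relation.Nullary using (¬_)
open import Relation.Binary.PropositionalEquality
  using (_≡_; refl; sym; trans; cong; subst; subst₂; module ≡-Reasoning)

module _ {M : Set} where

  data EvenSnoc : List M → Set where
    []    : EvenSnoc []
    _▷_,_ : ∀ {u} → EvenSnoc u → (a b : M) → EvenSnoc (u ++ a ∷ b ∷ [])

  prependPair : ∀ {u} (x y : M) → EvenSnoc u → EvenSnoc (x ∷ y ∷ u)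
  prependPair x y []          = [] ▷ x , y
  prependPair x y (v ▷ a , b) = prependPair x y v ▷ a , b

  evenSnoc : ∀ (t : List M) → Even (length t) → EvenSnoc t
  evenSnoc []          _ = []
  evenSnoc (x ∷ y ∷ t) e = prependPair x y (evenSnoc t e)

  reaches[] : (ψ : List M → Set) → (∀ s a b → ψ (s ++ a ∷ b ∷ []) → ψ s) →
              ∀ {t} → EvenSnoc t → ψ t → ψ []
  reaches[] ψ closed []          p = p
  reaches[] ψ closed (u ▷ a , b) p = reaches[] ψ closed u (closed _ a b p)

  length-pair : ∀ (u : List M) a b → length (u ++ a ∷ b ∷ []) ≡ suc (suc (length u))
  length-pair u a b = trans (length-++ u) (+-comm (length u) 2)

  take-snoc : ∀ (u : List M) a r → take (suc (length u)) (u ++ a ∷ r) ≡ u ++ [ a ]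
  take-snoc []      a r = refl
  take-snoc (x ∷ u) a r = cong (x ∷_) (take-snoc u a r)

  pair-assoc : ∀ (u : List M) a b → (u ++ [ a ]) ++ [ b ] ≡ u ++ a ∷ b ∷ []
  pair-assoc u a b = ++-assoc u [ a ] [ b ]

module GameFacts (G : Game) where
  open Game G

  ≈-length : ∀ {s t} → s ≈ t → length s ≡ length t
  ≈-length {s} {t} q = begin
    length s           ≡⟨ sym (length-map pol s) ⟩
    length (map pol s) ≡⟨ cong length (proj₁ (e1 q)) ⟩
    length (map pol t) ≡⟨ length-map pol t ⟩
    length t           ∎
    where open ≡-Reasoning

  []-≉-pair : ∀ v c d → ¬ ([] ≈ (v ++ c ∷ d ∷ []))
  []-≉-pair v c d q with trans (≈-length q) (length-pair v c d)
  ... | ()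

  ≈-dropLast : ∀ u a b v c d → (u ++ a ∷ b ∷ []) ≈ (v ++ c ∷ d ∷ []) →
               (u ++ [ a ]) ≈ (v ++ [ c ])
  ≈-dropLast u a b v c d q =
    subst₂ _≈_ (take-snoc u a [ b ]) (trans (cong takeV |u|≡|v|) (take-snoc v c [ d ]))
           (e2 q (suc (length u)))
    where
    takeV : ℕ → List Move
    takeV n = take (suc n) (v ++ c ∷ d ∷ [])
    |u|≡|v| : length u ≡ length v
    |u|≡|v| = suc-injective (suc-injective
      (trans (sym (length-pair u a b)) (trans (≈-length q) (length-pair v c d))))

  play-dropLast : ∀ u a b → Play (u ++ a ∷ b ∷ []) → Play (u ++ [ a ])
  play-dropLast u a b pl = play-prefix (u ++ [ a ]) [ b ] (subst Play (sym (pair-assoc u a b)) pl)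

  ≈-extendLast : ∀ s a b t a′ → Play (s ++ a ∷ b ∷ []) → (s ++ [ a ]) ≈ (t ++ [ a′ ]) →
                 ∃[ b′ ] ((s ++ a ∷ b ∷ []) ≈ (t ++ a′ ∷ b′ ∷ []))
  ≈-extendLast s a b t a′ pl q with e3 b q (subst Play (sym (pair-assoc s a b)) pl)
  ... | b′ , r = b′ , subst₂ _≈_ (pair-assoc s a b) (pair-assoc t a′ b′) r

  ≈-extendPair : ∀ u a b s → Play (u ++ a ∷ b ∷ []) → u ≈ s →
                 ∃[ a′ ] ∃[ b′ ] ((u ++ [ a ]) ≈ (s ++ [ a′ ]) ×
                                  (u ++ a ∷ b ∷ []) ≈ (s ++ a′ ∷ b′ ∷ []))
  ≈-extendPair u a b s pl q with e3 a q (play-dropLast u a b pl)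
  ... | a′ , qa with ≈-extendLast u a b s a′ pl qa
  ... | b′ , qb = a′ , b′ , qa , qb

module Skeletons (G : Game) (σ : Strategy G) (φ : List (Game.Move G) → Set)
                 (evenφ : EvenPlays G φ) where
  open Game G
  open GameFacts G
  open Strategy σ using () renaming (set to S)
  open IsStrategy (Strategy.isStrategy σ)
    using (repIndep; determ) renaming (evenPlays to evenS; causal to causalS)

  φ[] : ∃[ s ] φ s → CausallyConsistent G φ → φ []
  φ[] (s , p) causal = reaches[] φ causal (evenSnoc s (proj₂ (evenφ s p))) p

  module FromSkeletonOf (sk : IsSkeletonOf G φ S) where
    open IsSkeletonOf sk

    funDeterm : ∀ s a b c → φ (s ++ a ∷ b ∷ []) → φ (s ++ a ∷ c ∷ []) → b ≡ c
    funDeterm s a b c pb pc with uniform s a b (subset _ pb) (causal s a b pb)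
    ... | _ , _ , unique = trans (sym (unique pb)) (unique pc)

    -- Transport the σ-play s a b to t a′ by (e3); Uniformization picks the
    -- φ-answer b′ and Determinacy of σ makes it equivalent to s a b.
    funRepIndep : ∀ s a b t a′ → φ (s ++ a ∷ b ∷ []) → φ t → (s ++ [ a ]) ≈ (t ++ [ a′ ]) →
                  ∃[ b′ ] ((φ (t ++ a′ ∷ b′ ∷ []) × (s ++ a ∷ b ∷ []) ≈ (t ++ a′ ∷ b′ ∷ [])) ×
                           (∀ {y} → φ (t ++ a′ ∷ y ∷ []) × (s ++ a ∷ b ∷ []) ≈ (t ++ a′ ∷ y ∷ []) →
                                    b′ ≡ y))
    funRepIndep s a b t a′ pb pt q with ≈-extendLast s a b t a′ (proj₁ (evenφ _ pb)) q
    ... | b″ , q″ with uniform t a′ b″ (repIndep _ _ (subset _ pb) q″) pt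
    ... | b′ , pb′ , unique =
      b′ , (pb′ , determ s a b t a′ b′ (subset _ pb) (subset _ pb′) q) , λ w → unique (proj₁ w)

    isSkeleton : IsSkeleton G φ
    isSkeleton = record
      { evenPlays = evenφ ; nonempty = nonempty ; causal = causal
      ; funDeterm = funDeterm ; funRepIndep = funRepIndep }

    bullet⊆σ : ∀ t → bullet G φ t → S t
    bullet⊆σ t (s , p , q) = repIndep s t (subset s p) q

    σ⊆bullet : ∀ {t} → EvenSnoc t → S t → bullet G φ t
    σ⊆bullet [] _ = [] , φ[] nonempty causal , ≈-refl (proj₁ (evenφ [] (φ[] nonempty causal)))
    σ⊆bullet (_▷_,_ {u} view a b) st
      with σ⊆bullet view (causalS u a b st)
    ... | s , ps , s≈u
      with ≈-extendPair u a b s (proj₁ (evenS _ st)) (≈-sym s≈u)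
    ... | a′ , b″ , qa , qb
      with uniform s a′ b″ (repIndep _ _ st qb) ps
    ... | b′ , pb′ , _ =
      s ++ a′ ∷ b′ ∷ [] , pb′ , determ s a′ b′ u a b (subset _ pb′) st (≈-sym qa)

    bullet≐σ : _≐_ G (bullet G φ) S
    bullet≐σ t = mk⇔ (bullet⊆σ t) (λ st → σ⊆bullet (evenSnoc t (proj₂ (evenS t st))) st)

  module FromSkeleton (sk : IsSkeleton G φ) (generates : _≐_ G (bullet G φ) S) where
    open IsSkeleton sk

    subset : ∀ s → φ s → S s
    subset s p = Equivalence.to (generates s) (s , p , ≈-refl (proj₁ (evenφ s p)))

    -- The σ-play s a b is equivalent to some φ-play u a″ b″; Functional
    -- Representation Independence moves its answer to s a, and Functional
    -- Determinacy makes that answer unique.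
    uniform : ∀ s a b → S (s ++ a ∷ b ∷ []) → φ s →
              ∃[ b′ ] (φ (s ++ a ∷ b′ ∷ []) × (∀ {y} → φ (s ++ a ∷ y ∷ []) → b′ ≡ y))
    uniform s a b st ps with Equivalence.from (generates _) st
    ... | t , pt , q = answer (evenSnoc t (proj₂ (evenφ t pt))) pt q
      where
      answer : ∀ {t} → EvenSnoc t → φ t → t ≈ (s ++ a ∷ b ∷ []) →
               ∃[ b′ ] (φ (s ++ a ∷ b′ ∷ []) × (∀ {y} → φ (s ++ a ∷ y ∷ []) → b′ ≡ y))
      answer [] _ q = ⊥-elim ([]-≉-pair s a b q)
      answer (_▷_,_ {u} _ a″ b″) pt q
        with funRepIndep u a″ b″ s a pt ps (≈-dropLast u a″ b″ s a b q)
      ... | b′ , (pb′ , _) , _ = b′ , pb′ , λ py → funDeterm s a b′ _ pb′ py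

    isSkeletonOf : IsSkeletonOf G φ S
    isSkeletonOf = record
      { subset = subset ; nonempty = nonempty ; causal = causal ; uniform = uniform }

mainTheorem13 : (G : Game) (σ : Strategy G) (φ : List (Game.Move G) → Set) →
    EvenPlays G φ →
    IsSkeletonOf G φ (Strategy.set σ) ⇔ (IsSkeleton G φ × _≐_ G (bullet G φ) (Strategy.set σ))
mainTheorem13 G σ φ evenφ = mk⇔
  (λ sk → FromSkeletonOf.isSkeleton sk , FromSkeletonOf.bullet≐σ sk)
  (λ (sk , generates) → FromSkeleton.isSkeletonOf sk generates)
  where open Skeletons G σ φ evenφ
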